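{- Let $n\geq 3$ and $k\geq 2$. Suppose that edge-disjoint subgraphs $G_1,\dots,G_k$ of $K_n$ satisfy $\sum_{i=1}^k\mathrm{Mad}(G_i)=M(k,n)$, and let $X_j\subseteq V(G_j)$ for $j=1,\dots,k$ satisfy $2e(G_j[X_j])/|X_j|=\mathrm{Mad}(G_j)$. Then $X_1\cup\dots\cup X_k=V(K_n)$.
   Context: For a finite graph $G$, $\mathrm{Mad}(G)=\max\{2e(H)/|V(H)| : H\subseteq G,\ |V(H)|\geq 1\}$; $G[X]$ is the subgraph induced by $X$. $M(k,n)$ is the maximum of $\sum_{i=1}^k\mathrm{Mad}(G_i)$ over all partitions of $E(K_n)$ into $k$ spanning subgraphs (equivalently over all families of $k$ pairwise edge-disjoint subgraphs of $K_n$). -}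

module Defs where

open import Data.Nat.Base using (ℕ; zero; suc; _*_)
open import Data.Fin.Base using (Fin; toℕ) renaming (zero to fz; suc to fs)
open import Data.Fin.Subset using (Subset; inside; outside; ∣_∣)
open import Data.Bool.Base using (Bool; true; false; _∧_)
open import Data.Vec.Base using (Vec; []; _∷_; lookup)
open import Data.List.Base using (List; []; _∷_; map; _++_; concatMap; filterᵇ; length; foldr; allFin)
open import Data.Product.Base using (_×_; _,_)
open import Data.Nat.Base using (_<ᵇ_) renaming (_<_ to _<ℕ_)
open import Relation.Binary.PropositionalEquality using (_≡_; _≢_)
open import Data.Integer.Base using (+_)
open import Data.Rational.Base using (ℚ; 0ℚ; _+_; _⊔_; _≤_; _/_)

-- A (simple) subgraph of K_n, viewed as a spanning subgraph on vertex set Fin n.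
-- Edges are given by a Boolean function; only the values E i j with
-- toℕ i < toℕ j are ever consulted, so {i,j} (i ≠ j) is an edge iff
-- E i j ≡ true for the ordered representative i < j.
Graph : ℕ → Set
Graph n = Fin n → Fin n → Bool

pairs : (n : ℕ) → List (Fin n × Fin n)
pairs n = concatMap (λ i → map (λ j → (i , j)) (filterᵇ (λ j → toℕ i <ᵇ toℕ j) (allFin n))) (allFin n)

eInduced : ∀ {n} → Graph n → Subset n → ℕ
eInduced {n} G X = length (filterᵇ (λ { (i , j) → lookup X i ∧ lookup X j ∧ G i j }) (pairs n))

-- 2 e(G[X]) / |X| as a rational (only meaningful for nonempty X;
-- set to 0 for X empty, which is never the maximum-relevant case).
density : ∀ {n} → Graph n → Subset n → ℚ
density G X with ∣ X ∣
... | zero  = 0ℚ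
... | suc m = (+ (2 * eInduced G X)) / suc m

allSubsets : (n : ℕ) → List (Subset n)
allSubsets zero    = [] ∷ []
allSubsets (suc n) = map (inside ∷_) (allSubsets n) ++ map (outside ∷_) (allSubsets n)

-- Mad(G) = max over nonempty X ⊆ V(G) of 2e(G[X])/|X|.
-- (Densities are ≥ 0 and singletons give 0, so folding ⊔ from 0 and
--  including the empty set with value 0 gives exactly this maximum for n ≥ 1.)
Mad : ∀ {n} → Graph n → ℚ
Mad {n} G = foldr (λ X q → density G X ⊔ q) 0ℚ (allSubsets n)

sumℚ : ∀ {k} → (Fin k → ℚ) → ℚ
sumℚ {zero}  f = 0ℚ
sumℚ {suc k} f = f fz + sumℚ (λ i → f (fs i))

EdgeDisjoint : ∀ {k n} → (Fin k → Graph n) → Set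
EdgeDisjoint {k} {n} G =
  ∀ (a b : Fin k) → a ≢ b → ∀ (i j : Fin n) → toℕ i <ℕ toℕ j →
  G a i j ≡ true → G b i j ≡ false

-- "Σ Mad(G_i) = M(k,n)": since M(k,n) is the maximum of Σ Mad over all
-- families of k pairwise edge-disjoint subgraphs of K_n and G is such a
-- family, this is: no such family has a larger sum.
AttainsM : ∀ {k n} → (Fin k → Graph n) → Set
AttainsM {k} {n} G =
  EdgeDisjoint G × (∀ (H : Fin k → Graph n) → EdgeDisjoint H →
                      sumℚ (λ i → Mad (H i)) ≤ sumℚ (λ i → Mad (G i)))

-- If some vertex v lay in no X_j, move every edge of K_n at v into G_0 and delete it from
-- the other G_j; the family stays edge-disjoint. Each X_j avoids v, so G_j[X_j] is unchanged
-- and no Mad(G_j) drops. In the new G_0 the set X_0 ∪ {v} spans e + m edges on m + 1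
-- vertices, where m = |X_0| and e = e(G_0[X_0]) < m², and 2(e + m)/(m + 1) > 2e/m = Mad(G_0).
-- So Σ Mad(G_j) strictly increases, contradicting maximality.

{-# OPTIONS --safe #-}
module Submission where

open import Defs
open import Data.Nat.Base using (ℕ; _≥_)
open import Data.Fin.Base using (Fin)
open import Data.Fin.Subset using (Subset; _∈_; Nonempty)
open import Data.Product.Base using (∃)
open import Relation.Binary.PropositionalEquality using (_≡_)

open import Function.Base using (_∘_; id)
open import Data.Bool.Base using (Bool; true; false; _∧_; _∨_; if_then_else_)
open import Data.Nat.Base using (zero; suc; pred; >-nonZero; _+_; _*_; _≤_; _<_; z≤n; s≤s; _<ᵇ_)
open import Data.Nat.Properties
  using (+-identityʳ; +-comm; *-suc; *-assoc; *-distribʳ-+; *-distribˡ-+; +-mono-≤; +-monoʳ-<; *-monoʳ-<; ≤-refl; ≤-trans; <-≤-trans; m<m+n; suc-pred; +-*-semiring; module ≤-Reasoning)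
open import Data.Fin.Base using (toℕ) renaming (zero to fzero; suc to fsuc)
open import Data.Fin.Properties using (_≟_; any?; toℕ-injective)
open import Data.Fin.Subset using (_∉_; ∣_∣; ⁅_⁆; _∪_)
open import Data.Fin.Subset.Properties using (_∈?_; ∣p∣≤∣x∷p∣; ∪-identityˡ)
open import Data.Vec.Base using ([]; _∷_; lookup; here; there)
open import Data.Vec.Properties using (lookup⇒[]=; lookup-zipWith; lookup-replicate)
open import Data.List.Base using (List; []; _∷_; _++_; map; filterᵇ; length; foldr; concatMap; tabulate; allFin)
import Data.List.Membership.Propositional as List
open import Data.List.Membership.Propositional.Properties using (∈-++⁺ˡ; ∈-++⁺ʳ; ∈-map⁺)
open import Data.List.Relation.Unary.Any using (here; there)
open import Data.Product.Base using (_×_; _,_)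
open import Relation.Nullary using (yes; no; does; contradiction)
open import Relation.Nullary.Decidable using (dec-true)
open import Relation.Binary.PropositionalEquality using (_≢_; refl; sym; trans; cong; cong₂; subst; module ≡-Reasoning)
open import Data.Integer.Base using (+_)
open import Data.Rational.Base using (ℚ; 0ℚ; _⊔_) renaming (_≤_ to _≤ℚ_; _<_ to _<ℚ_; _/_ to _/ℚ_)
import Data.Rational.Properties as ℚ
import Data.Rational.Unnormalised.Base as ℚᵘ
import Data.Rational.Unnormalised.Properties as ℚᵘ
import Data.Integer.Properties as ℤ
open import Algebra.Properties.Semiring.Sum +-*-semiring
  using (sum; sum-cong-≗; sum-replicate-zero; ∑-distrib-+; ∑-comm; *-distribˡ-sum; *-distribʳ-sum)

[_] : Bool → ℕ
[ true  ] = 1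
[ false ] = 0

[∧] : ∀ a b → [ a ∧ b ] ≡ [ a ] * [ b ]
[∧] true  b = sym (+-identityʳ [ b ])
[∧] false b = refl

<ᵇ-irrefl : ∀ m → (m <ᵇ m) ≡ false
<ᵇ-irrefl zero    = refl
<ᵇ-irrefl (suc m) = <ᵇ-irrefl m

[<ᵇ]+[>ᵇ]≡1 : ∀ {m n} → m ≢ n → [ m <ᵇ n ] + [ n <ᵇ m ] ≡ 1
[<ᵇ]+[>ᵇ]≡1 {zero}  {zero}  m≢n = contradiction refl m≢n
[<ᵇ]+[>ᵇ]≡1 {zero}  {suc n} _   = refl
[<ᵇ]+[>ᵇ]≡1 {suc m} {zero}  _   = refl
[<ᵇ]+[>ᵇ]≡1 {suc m} {suc n} m≢n = [<ᵇ]+[>ᵇ]≡1 (m≢n ∘ cong suc)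

sum-mono-≤ : ∀ {n} {f g : Fin n → ℕ} → (∀ i → f i ≤ g i) → sum f ≤ sum g
sum-mono-≤ {zero}  _   = z≤n
sum-mono-≤ {suc n} f≤g = +-mono-≤ (f≤g fzero) (sum-mono-≤ (f≤g ∘ fsuc))

sum-δ : ∀ {n} (v : Fin n) (b : Fin n → Bool) → sum (λ i → [ does (i ≟ v) ∧ b i ]) ≡ [ b v ]
sum-δ {suc n} fzero    b = trans (cong (_+_ [ b fzero ]) (sum-replicate-zero n)) (+-identityʳ _)
sum-δ {suc n} (fsuc v) b = sum-δ v (b ∘ fsuc)

∑∑-distrib-+ : ∀ {m n} (f g : Fin m → Fin n → ℕ) →
               sum (λ i → sum λ j → f i j + g i j) ≡ sum (λ i → sum (f i)) + sum (λ i → sum (g i))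
∑∑-distrib-+ f g = trans (sum-cong-≗ λ i → ∑-distrib-+ (f i) (g i)) (∑-distrib-+ (λ i → sum (f i)) (λ i → sum (g i)))

∑∑[∧]≡∑*∑ : ∀ {m n} (b : Fin m → Bool) (c : Fin n → Bool) →
            sum (λ i → sum λ j → [ b i ∧ c j ]) ≡ sum ([_] ∘ b) * sum ([_] ∘ c)
∑∑[∧]≡∑*∑ b c = begin
  sum (λ i → sum λ j → [ b i ∧ c j ])      ≡⟨ sum-cong-≗ (λ i → sum-cong-≗ λ j → [∧] (b i) (c j)) ⟩
  sum (λ i → sum λ j → [ b i ] * [ c j ])  ≡⟨ sum-cong-≗ (λ i → sym (*-distribˡ-sum [ b i ] ([_] ∘ c))) ⟩
  sum (λ i → [ b i ] * sum ([_] ∘ c))      ≡⟨ sym (*-distribʳ-sum (sum ([_] ∘ c)) ([_] ∘ b)) ⟩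
  sum ([_] ∘ b) * sum ([_] ∘ c)            ∎
  where open ≡-Reasoning

∣p∣≡∑ : ∀ {n} (p : Subset n) → ∣ p ∣ ≡ sum (λ i → [ lookup p i ])
∣p∣≡∑ []          = refl
∣p∣≡∑ (true  ∷ p) = cong suc (∣p∣≡∑ p)
∣p∣≡∑ (false ∷ p) = ∣p∣≡∑ p

∉⇒lookup≡false : ∀ {n} {x : Fin n} {p : Subset n} → x ∉ p → lookup p x ≡ false
∉⇒lookup≡false {x = x} {p} x∉p with lookup p x in eq
... | true  = contradiction (lookup⇒[]= x p eq) x∉p
... | false = refl

Nonempty⇒∣p∣>0 : ∀ {n} {p : Subset n} → Nonempty p → 0 < ∣ p ∣
Nonempty⇒∣p∣>0 (_ , here)                       = s≤s z≤n
Nonempty⇒∣p∣>0 (_ , there {y = b} {xs = p} x∈p) = ≤-trans (Nonempty⇒∣p∣>0 (_ , x∈p)) (∣p∣≤∣x∷p∣ b p)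

lookup-⁅⁆ : ∀ {n} (v i : Fin n) → lookup ⁅ v ⁆ i ≡ does (i ≟ v)
lookup-⁅⁆ fzero    fzero    = refl
lookup-⁅⁆ fzero    (fsuc i) = lookup-replicate i false
lookup-⁅⁆ (fsuc v) fzero    = refl
lookup-⁅⁆ (fsuc v) (fsuc i) = lookup-⁅⁆ v i

lookup-⁅⁆∪ : ∀ {n} (v : Fin n) (p : Subset n) i → lookup (⁅ v ⁆ ∪ p) i ≡ does (i ≟ v) ∨ lookup p i
lookup-⁅⁆∪ v p i = trans (lookup-zipWith _∨_ i ⁅ v ⁆ p) (cong (_∨ lookup p i) (lookup-⁅⁆ v i))

∣⁅x⁆∪p∣≡1+∣p∣ : ∀ {n} {x : Fin n} {p : Subset n} → x ∉ p → ∣ ⁅ x ⁆ ∪ p ∣ ≡ suc ∣ p ∣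
∣⁅x⁆∪p∣≡1+∣p∣ {x = fzero}  {true  ∷ p} x∉p = contradiction here x∉p
∣⁅x⁆∪p∣≡1+∣p∣ {x = fzero}  {false ∷ p} _   = cong (suc ∘ ∣_∣) (∪-identityˡ p)
∣⁅x⁆∪p∣≡1+∣p∣ {x = fsuc x} {true  ∷ p} x∉p = cong suc (∣⁅x⁆∪p∣≡1+∣p∣ (x∉p ∘ there))
∣⁅x⁆∪p∣≡1+∣p∣ {x = fsuc x} {false ∷ p} x∉p = ∣⁅x⁆∪p∣≡1+∣p∣ (x∉p ∘ there)

count : ∀ {A : Set} → (A → Bool) → List A → ℕ
count p xs = length (filterᵇ p xs)

count-++ : ∀ {A : Set} (p : A → Bool) xs ys → count p (xs ++ ys) ≡ count p xs + count p ys
count-++ p []       ys = refl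
count-++ p (x ∷ xs) ys with p x
... | true  = cong suc (count-++ p xs ys)
... | false = count-++ p xs ys

count-map : ∀ {A B : Set} (p : B → Bool) (f : A → B) xs → count p (map f xs) ≡ count (p ∘ f) xs
count-map p f []       = refl
count-map p f (x ∷ xs) with p (f x)
... | true  = cong suc (count-map p f xs)
... | false = count-map p f xs

count-filterᵇ : ∀ {A : Set} (p q : A → Bool) xs → count p (filterᵇ q xs) ≡ count (λ x → q x ∧ p x) xs
count-filterᵇ p q []       = refl
count-filterᵇ p q (x ∷ xs) with q x
... | false = count-filterᵇ p q xs
... | true with p x
...   | true  = cong suc (count-filterᵇ p q xs)
...   | false = count-filterᵇ p q xs

count-tabulate : ∀ {A : Set} {n} (p : A → Bool) (f : Fin n → A) → count p (tabulate f) ≡ sum (λ i → [ p (f i) ])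
count-tabulate {n = zero}  p f = refl
count-tabulate {n = suc n} p f with p (f fzero)
... | true  = cong suc (count-tabulate p (f ∘ fsuc))
... | false = count-tabulate p (f ∘ fsuc)

count-concatMap : ∀ {A B : Set} {n} (p : B → Bool) (f : A → List B) (g : Fin n → A) →
                  count p (concatMap f (tabulate g)) ≡ sum (λ i → count p (f (g i)))
count-concatMap {n = zero}  p f g = refl
count-concatMap {n = suc n} p f g =
  trans (count-++ p (f (g fzero)) _) (cong (_+_ (count p (f (g fzero)))) (count-concatMap p f (g ∘ fsuc)))

count-pairs : ∀ {n} (R : Fin n × Fin n → Bool) →
              count R (pairs n) ≡ sum λ i → sum λ j → [ (toℕ i <ᵇ toℕ j) ∧ R (i , j) ]
count-pairs {n} R = trans (count-concatMap R row id) (sum-cong-≗ λ i → begin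
  count R (map (i ,_) (above i))                  ≡⟨ count-map R (i ,_) (above i) ⟩
  count (R ∘ (i ,_)) (above i)                    ≡⟨ count-filterᵇ (R ∘ (i ,_)) (λ j → toℕ i <ᵇ toℕ j) (allFin n) ⟩
  count (edge i) (allFin n)                       ≡⟨ count-tabulate (edge i) id ⟩
  sum (λ j → [ edge i j ])                        ∎)
  where
  open ≡-Reasoning
  above : Fin n → List (Fin n)
  above i = filterᵇ (λ j → toℕ i <ᵇ toℕ j) (allFin n)
  row : Fin n → List (Fin n × Fin n)
  row i = map (i ,_) (above i)
  edge : Fin n → Fin n → Bool
  edge i j = (toℕ i <ᵇ toℕ j) ∧ R (i , j)

inducedEdge : ∀ {n} → Graph n → Subset n → Fin n → Fin n → Bool
inducedEdge G X i j = (toℕ i <ᵇ toℕ j) ∧ lookup X i ∧ lookup X j ∧ G i j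

eInduced≡∑∑ : ∀ {n} (G : Graph n) (X : Subset n) → eInduced G X ≡ sum λ i → sum λ j → [ inducedEdge G X i j ]
eInduced≡∑∑ {n} G X = count-pairs {n} _

AgreeOn : ∀ {n} → Subset n → Graph n → Graph n → Set
AgreeOn X G H = ∀ {i j} → i ∈ X → j ∈ X → G i j ≡ H i j

inducedEdge-cong : ∀ {n} {G H : Graph n} {X : Subset n} → AgreeOn X G H → ∀ i j → inducedEdge G X i j ≡ inducedEdge H X i j
inducedEdge-cong {X = X} agree i j with lookup X i in xi | lookup X j in xj
... | true  | true  = cong ((toℕ i <ᵇ toℕ j) ∧_) (agree (lookup⇒[]= i X xi) (lookup⇒[]= j X xj))
... | true  | false = refl
... | false | _     = refl

eInduced-cong : ∀ {n} {G H : Graph n} {X : Subset n} → AgreeOn X G H → eInduced G X ≡ eInduced H X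
eInduced-cong {G = G} {H} {X} agree = begin
  eInduced G X                                   ≡⟨ eInduced≡∑∑ G X ⟩
  sum (λ i → sum λ j → [ inducedEdge G X i j ])  ≡⟨ sum-cong-≗ (λ i → sum-cong-≗ λ j → cong [_] (inducedEdge-cong agree i j)) ⟩
  sum (λ i → sum λ j → [ inducedEdge H X i j ])  ≡⟨ eInduced≡∑∑ H X ⟨
  eInduced H X                                   ∎
  where open ≡-Reasoning

inducedEdge+diagonal≤ : ∀ {n} (G : Graph n) (X : Subset n) i j →
                        [ inducedEdge G X i j ] + [ does (j ≟ i) ∧ lookup X j ] ≤ [ lookup X i ∧ lookup X j ]
inducedEdge+diagonal≤ G X i j with j ≟ i
... | yes refl rewrite <ᵇ-irrefl (toℕ i) with lookup X i
...   | true  = ≤-refl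
...   | false = z≤n
inducedEdge+diagonal≤ G X i j | no _ with toℕ i <ᵇ toℕ j | lookup X i | lookup X j | G i j
...   | false | _     | _     | _     = z≤n
...   | true  | false | _     | _     = z≤n
...   | true  | true  | false | _     = z≤n
...   | true  | true  | true  | false = z≤n
...   | true  | true  | true  | true  = ≤-refl

eInduced+∣p∣≤∣p∣² : ∀ {n} (G : Graph n) (X : Subset n) → eInduced G X + ∣ X ∣ ≤ ∣ X ∣ * ∣ X ∣
eInduced+∣p∣≤∣p∣² G X = begin
  eInduced G X + ∣ X ∣
    ≡⟨ cong₂ _+_ (eInduced≡∑∑ G X) (trans (∣p∣≡∑ X) (sum-cong-≗ diagonal)) ⟩
  sum (λ i → sum (E i)) + sum (λ i → sum (D i))
    ≡⟨ ∑∑-distrib-+ E D ⟨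
  sum (λ i → sum λ j → E i j + D i j)
    ≤⟨ sum-mono-≤ (λ i → sum-mono-≤ (inducedEdge+diagonal≤ G X i)) ⟩
  sum (λ i → sum λ j → [ lookup X i ∧ lookup X j ])
    ≡⟨ ∑∑[∧]≡∑*∑ (lookup X) (lookup X) ⟩
  sum ([_] ∘ lookup X) * sum ([_] ∘ lookup X)
    ≡⟨ cong₂ _*_ (∣p∣≡∑ X) (∣p∣≡∑ X) ⟨
  ∣ X ∣ * ∣ X ∣ ∎
  where
  open ≤-Reasoning
  E D : Fin _ → Fin _ → ℕ
  E i j = [ inducedEdge G X i j ]
  D i j = [ does (j ≟ i) ∧ lookup X j ]
  diagonal : ∀ i → [ lookup X i ] ≡ sum (D i)
  diagonal i = sym (sum-δ i (lookup X))

touches : ∀ {n} → Fin n → Fin n → Fin n → Bool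
touches v i j = does (i ≟ v) ∨ does (j ≟ v)

addStar : ∀ {n} → Fin n → Graph n → Graph n
addStar v G i j = if touches v i j then true else G i j

starEdge : ∀ {n} → Fin n → Subset n → Fin n → Fin n → ℕ
starEdge v X i j = [ does (i ≟ v) ∧ (lookup X j ∧ (toℕ i <ᵇ toℕ j)) ] + [ does (j ≟ v) ∧ (lookup X i ∧ (toℕ i <ᵇ toℕ j)) ]

addStar-inducedEdge : ∀ {n} (G : Graph n) {X : Subset n} {v : Fin n} → v ∉ X → ∀ i j →
                      [ inducedEdge (addStar v G) (⁅ v ⁆ ∪ X) i j ] ≡ [ inducedEdge G X i j ] + starEdge v X i j
addStar-inducedEdge G {X} {v} v∉X i j rewrite lookup-⁅⁆∪ v X i | lookup-⁅⁆∪ v X j with i ≟ v | j ≟ v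
... | yes refl | yes refl rewrite <ᵇ-irrefl (toℕ i) | ∉⇒lookup≡false v∉X = refl
... | yes refl | no _     rewrite ∉⇒lookup≡false v∉X with toℕ i <ᵇ toℕ j | lookup X j
...   | true  | true  = refl
...   | true  | false = refl
...   | false | true  = refl
...   | false | false = refl
addStar-inducedEdge G {X} v∉X i j | no _ | yes refl rewrite ∉⇒lookup≡false v∉X with toℕ i <ᵇ toℕ j | lookup X i
...   | true  | true  = refl
...   | true  | false = refl
...   | false | true  = refl
...   | false | false = refl
addStar-inducedEdge G v∉X i j | no _ | no _ = sym (+-identityʳ _)

∑∑starEdge≡∣p∣ : ∀ {n} {X : Subset n} {v : Fin n} → v ∉ X → sum (λ i → sum (starEdge v X i)) ≡ ∣ X ∣
∑∑starEdge≡∣p∣ {X = X} {v} v∉X = begin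
  sum (λ i → sum (starEdge v X i))
    ≡⟨ ∑∑-distrib-+ out into ⟩
  sum (λ i → sum (out i)) + sum (λ i → sum (into i))
    ≡⟨ cong₂ _+_ (trans (∑-comm out) (sum-cong-≗ λ j → sum-δ v (λ i → lookup X j ∧ (toℕ i <ᵇ toℕ j))))
                 (sum-cong-≗ λ i → sum-δ v (λ j → lookup X i ∧ (toℕ i <ᵇ toℕ j))) ⟩
  sum (λ j → [ lookup X j ∧ (toℕ v <ᵇ toℕ j) ]) + sum (λ j → [ lookup X j ∧ (toℕ j <ᵇ toℕ v) ])
    ≡⟨ ∑-distrib-+ (λ j → [ lookup X j ∧ (toℕ v <ᵇ toℕ j) ]) (λ j → [ lookup X j ∧ (toℕ j <ᵇ toℕ v) ]) ⟨
  sum (λ j → [ lookup X j ∧ (toℕ v <ᵇ toℕ j) ] + [ lookup X j ∧ (toℕ j <ᵇ toℕ v) ])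
    ≡⟨ sum-cong-≗ either-side ⟩
  sum (λ j → [ lookup X j ])
    ≡⟨ ∣p∣≡∑ X ⟨
  ∣ X ∣ ∎
  where
  open ≡-Reasoning
  out into : Fin _ → Fin _ → ℕ
  out  i j = [ does (i ≟ v) ∧ (lookup X j ∧ (toℕ i <ᵇ toℕ j)) ]
  into i j = [ does (j ≟ v) ∧ (lookup X i ∧ (toℕ i <ᵇ toℕ j)) ]
  either-side : ∀ j → [ lookup X j ∧ (toℕ v <ᵇ toℕ j) ] + [ lookup X j ∧ (toℕ j <ᵇ toℕ v) ] ≡ [ lookup X j ]
  either-side j with lookup X j in xj | j ≟ v
  ... | false | _        = refl
  ... | true  | yes refl = contradiction (lookup⇒[]= j X xj) v∉X
  ... | true  | no j≢v   = [<ᵇ]+[>ᵇ]≡1 (j≢v ∘ sym ∘ toℕ-injective)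

eInduced-addStar : ∀ {n} (G : Graph n) {X : Subset n} {v : Fin n} → v ∉ X →
                   eInduced (addStar v G) (⁅ v ⁆ ∪ X) ≡ eInduced G X + ∣ X ∣
eInduced-addStar G {X} {v} v∉X = begin
  eInduced (addStar v G) (⁅ v ⁆ ∪ X)
    ≡⟨ eInduced≡∑∑ (addStar v G) (⁅ v ⁆ ∪ X) ⟩
  sum (λ i → sum λ j → [ inducedEdge (addStar v G) (⁅ v ⁆ ∪ X) i j ])
    ≡⟨ sum-cong-≗ (λ i → sum-cong-≗ (addStar-inducedEdge G v∉X i)) ⟩
  sum (λ i → sum λ j → [ inducedEdge G X i j ] + starEdge v X i j)
    ≡⟨ ∑∑-distrib-+ (λ i j → [ inducedEdge G X i j ]) (starEdge v X) ⟩
  sum (λ i → sum λ j → [ inducedEdge G X i j ]) + sum (λ i → sum (starEdge v X i))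
    ≡⟨ cong₂ _+_ (sym (eInduced≡∑∑ G X)) (∑∑starEdge≡∣p∣ {X = X} {v} v∉X) ⟩
  eInduced G X + ∣ X ∣ ∎
  where open ≡-Reasoning

2e[1+m]<2[e+m]m : ∀ e m → e < m * m → 2 * e * suc m < 2 * (e + m) * m
2e[1+m]<2[e+m]m e m e<m² = begin-strict
  2 * e * suc m            ≡⟨ *-suc (2 * e) m ⟩
  2 * e + 2 * e * m        ≡⟨ +-comm (2 * e) (2 * e * m) ⟩
  2 * e * m + 2 * e        <⟨ +-monoʳ-< (2 * e * m) (*-monoʳ-< 2 e<m²) ⟩
  2 * e * m + 2 * (m * m)  ≡⟨ cong (_+_ (2 * e * m)) (sym (*-assoc 2 m m)) ⟩
  2 * e * m + 2 * m * m    ≡⟨ sym (*-distribʳ-+ m (2 * e) (2 * m)) ⟩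
  (2 * e + 2 * m) * m      ≡⟨ cong (_* m) (sym (*-distribˡ-+ 2 e m)) ⟩
  2 * (e + m) * m          ∎
  where open ≤-Reasoning

-- _/_ normalises, but its image in ℚᵘ is ≃ mkℚᵘ (+ a) c, whose order is cross-multiplication.
cross-<⇒/< : ∀ a b c d → a * suc d < b * suc c → + a /ℚ suc c <ℚ + b /ℚ suc d
cross-<⇒/< a b c d ad<bc = ℚ.toℚᵘ-cancel-<
  (ℚᵘ.<-respʳ-≃ (ℚᵘ.≃-sym (ℚ.toℚᵘ-fromℚᵘ (ℚᵘ.mkℚᵘ (+ b) d)))
    (ℚᵘ.<-respˡ-≃ (ℚᵘ.≃-sym (ℚ.toℚᵘ-fromℚᵘ (ℚᵘ.mkℚᵘ (+ a) c))) (ℚᵘ.*<* (ℤ.+◃-mono-< ad<bc))))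

density≡2e/m : ∀ {n} (G : Graph n) (X : Subset n) {m e} → ∣ X ∣ ≡ suc m → eInduced G X ≡ e →
               density G X ≡ + (2 * e) /ℚ suc m
density≡2e/m G X {m} |X|≡ refl with ∣ X ∣ | |X|≡
... | .(suc m) | refl = refl

density-cong : ∀ {n} {G H : Graph n} (X : Subset n) → eInduced G X ≡ eInduced H X → density G X ≡ density H X
density-cong X eq with ∣ X ∣
... | zero  = refl
... | suc m = cong (λ e → + (2 * e) /ℚ suc m) eq

density<density-addStar : ∀ {n} (G : Graph n) {X : Subset n} {v : Fin n} → v ∉ X → Nonempty X →
                          density G X <ℚ density (addStar v G) (⁅ v ⁆ ∪ X)
density<density-addStar G {X} {v} v∉X nonempty = begin-strict
  density G X                                  ≡⟨ density≡2e/m G X |X|≡ refl ⟩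
  + (2 * e) /ℚ suc m                           <⟨ cross-<⇒/< (2 * e) (2 * (e + suc m)) m (suc m) (2e[1+m]<2[e+m]m e (suc m) e<m²) ⟩
  + (2 * (e + suc m)) /ℚ suc (suc m)           ≡⟨ density≡2e/m (addStar v G) (⁅ v ⁆ ∪ X) ∣X∪v∣≡ eInduced≡ ⟨
  density (addStar v G) (⁅ v ⁆ ∪ X)            ∎
  where
  open ℚ.≤-Reasoning
  m e : ℕ
  m = pred ∣ X ∣
  |X|≡ : ∣ X ∣ ≡ suc m
  e = eInduced G X
  |X|≡ = sym (suc-pred ∣ X ∣ {{>-nonZero (Nonempty⇒∣p∣>0 nonempty)}})
  e<m² : e < suc m * suc m
  e<m² = <-≤-trans (m<m+n e (s≤s z≤n)) (subst (λ t → e + t ≤ t * t) |X|≡ (eInduced+∣p∣≤∣p∣² G X))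
  ∣X∪v∣≡ : ∣ ⁅ v ⁆ ∪ X ∣ ≡ suc (suc m)
  ∣X∪v∣≡ = trans (∣⁅x⁆∪p∣≡1+∣p∣ v∉X) (cong suc |X|≡)
  eInduced≡ : eInduced (addStar v G) (⁅ v ⁆ ∪ X) ≡ e + suc m
  eInduced≡ = trans (eInduced-addStar G v∉X) (cong (_+_ e) |X|≡)

≤-foldr-⊔ : ∀ {A : Set} (f : A → ℚ) z {x xs} → x List.∈ xs → f x ≤ℚ foldr (λ y q → f y ⊔ q) z xs
≤-foldr-⊔ f z (here refl)  = ℚ.p≤p⊔q (f _) _
≤-foldr-⊔ f z (there x∈xs) = ℚ.≤-trans (≤-foldr-⊔ f z x∈xs) (ℚ.p≤q⊔p (f _) _)

∈-allSubsets : ∀ {n} (X : Subset n) → X List.∈ allSubsets n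
∈-allSubsets []          = here refl
∈-allSubsets (true  ∷ X) = ∈-++⁺ˡ (∈-map⁺ (true ∷_) (∈-allSubsets X))
∈-allSubsets (false ∷ X) = ∈-++⁺ʳ _ (∈-map⁺ (false ∷_) (∈-allSubsets X))

density≤Mad : ∀ {n} (G : Graph n) (X : Subset n) → density G X ≤ℚ Mad G
density≤Mad G X = ≤-foldr-⊔ (density G) 0ℚ (∈-allSubsets X)

Mad≤Mad-agreeing : ∀ {n} {G H : Graph n} {X : Subset n} → density G X ≡ Mad G → AgreeOn X G H → Mad G ≤ℚ Mad H
Mad≤Mad-agreeing {G = G} {H} {X} densest agree = begin
  Mad G          ≡⟨ densest ⟨
  density G X    ≡⟨ density-cong X (eInduced-cong agree) ⟩
  density H X    ≤⟨ density≤Mad H X ⟩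
  Mad H          ∎
  where open ℚ.≤-Reasoning

sumℚ-mono-≤ : ∀ {k} {f g : Fin k → ℚ} → (∀ a → f a ≤ℚ g a) → sumℚ f ≤ℚ sumℚ g
sumℚ-mono-≤ {zero}  _   = ℚ.≤-refl
sumℚ-mono-≤ {suc k} f≤g = ℚ.+-mono-≤ (f≤g fzero) (sumℚ-mono-≤ (f≤g ∘ fsuc))

sumℚ-mono-< : ∀ {k} {f g : Fin k → ℚ} (a : Fin k) → (∀ b → f b ≤ℚ g b) → f a <ℚ g a → sumℚ f <ℚ sumℚ g
sumℚ-mono-< fzero    f≤g fa<ga = ℚ.+-mono-<-≤ fa<ga (sumℚ-mono-≤ (f≤g ∘ fsuc))
sumℚ-mono-< (fsuc a) f≤g fa<ga = ℚ.+-mono-≤-< (f≤g fzero) (sumℚ-mono-< a (f≤g ∘ fsuc) fa<ga)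

moveStar : ∀ {k n} → Fin k → Fin n → (Fin k → Graph n) → Fin k → Graph n
moveStar a₀ v G a i j = if touches v i j then does (a ≟ a₀) else G a i j

moveStar-self : ∀ {k n} (a₀ : Fin k) (v : Fin n) (G : Fin k → Graph n) → moveStar a₀ v G a₀ ≡ addStar v (G a₀)
moveStar-self a₀ v G = cong (λ b i j → if touches v i j then b else G a₀ i j) (dec-true (a₀ ≟ a₀) refl)

moveStar-agreeOn : ∀ {k n} (a₀ : Fin k) {v : Fin n} (G : Fin k → Graph n) {X : Subset n} → v ∉ X →
                   ∀ a → AgreeOn X (G a) (moveStar a₀ v G a)
moveStar-agreeOn a₀ {v} G v∉X a {i} {j} i∈X j∈X with i ≟ v | j ≟ v
... | yes refl | _        = contradiction i∈X v∉X
... | no _     | yes refl = contradiction j∈X v∉X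
... | no _     | no _     = refl

moveStar-edgeDisjoint : ∀ {k n} (a₀ : Fin k) (v : Fin n) {G : Fin k → Graph n} → EdgeDisjoint G → EdgeDisjoint (moveStar a₀ v G)
moveStar-edgeDisjoint a₀ v disjoint a b a≢b i j i<j with touches v i j
... | false = disjoint a b a≢b i j i<j
... | true with a ≟ a₀ | b ≟ a₀
...   | yes refl | yes refl = contradiction refl a≢b
...   | yes _    | no _     = λ _ → refl
...   | no _     | _        = λ ()

moveStar-increases-∑Mad : ∀ {k n} (G : Fin k → Graph n) (X : Fin k → Subset n) (a₀ : Fin k) (v : Fin n) →
                          (∀ a → density (G a) (X a) ≡ Mad (G a)) → Nonempty (X a₀) → (∀ a → v ∉ X a) →
                          sumℚ (λ a → Mad (G a)) <ℚ sumℚ (λ a → Mad (moveStar a₀ v G a))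
moveStar-increases-∑Mad G X a₀ v densest nonempty v∉X =
  sumℚ-mono-< a₀ (λ a → Mad≤Mad-agreeing (densest a) (moveStar-agreeOn a₀ G (v∉X a) a)) (begin-strict
    Mad (G a₀)                                 ≡⟨ densest a₀ ⟨
    density (G a₀) (X a₀)                      <⟨ density<density-addStar (G a₀) (v∉X a₀) nonempty ⟩
    density (addStar v (G a₀)) (⁅ v ⁆ ∪ X a₀)  ≤⟨ density≤Mad (addStar v (G a₀)) (⁅ v ⁆ ∪ X a₀) ⟩
    Mad (addStar v (G a₀))                     ≡⟨ cong Mad (moveStar-self a₀ v G) ⟨
    Mad (moveStar a₀ v G a₀)                   ∎)
  where open ℚ.≤-Reasoning

proposition3p5 : ∀ (n k : ℕ) → n ≥ 3 → k ≥ 2 →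
    (G : Fin k → Graph n) → AttainsM G →
    (X : Fin k → Subset n) →
    (∀ j → Nonempty (X j)) →
    (∀ j → density (G j) (X j) ≡ Mad (G j)) →
    ∀ (v : Fin n) → ∃ λ j → v ∈ X j
proposition3p5 n zero    _ ()
proposition3p5 n (suc k) _ _ G (disjoint , maximal) X nonempty densest v with any? (λ j → v ∈? X j)
... | yes covered  = covered
... | no uncovered =
  contradiction (ℚ.<-≤-trans gain (maximal (moveStar fzero v G) (moveStar-edgeDisjoint fzero v disjoint))) (ℚ.<-irrefl refl)
  where
  gain : sumℚ (λ a → Mad (G a)) <ℚ sumℚ (λ a → Mad (moveStar fzero v G a))
  gain = moveStar-increases-∑Mad G X fzero v densest (nonempty fzero) (λ j v∈Xj → uncovered (j , v∈Xj))
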